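{- For every $m\ge 1$, $\mathrm{Ind}(G_m)$ is (combinatorially equivalent to) the boundary complex of an $m$-dimensional simplicial polytope.
   Context: $\mathrm{Ind}(G)$ is the independence complex of $G$ (faces are independent sets). The graphs $G_m$: $G_1$ has vertices $a_1,b_1$ and edge $a_1b_1$; for $m\ge1$, $G_{m+1}$ is obtained from $G_m$ by adding vertices $a_{m+1},b_{m+1},c_{m+1}$ and edges $a_ma_{m+1}$, $b_mc_{m+1}$, $a_{m+1}b_{m+1}$, $b_{m+1}c_{m+1}$, and, when $m\ge2$, also $c_ma_{m+1}$. The boundary complex of a simplicial $d$-polytope is the simplicial complex of vertex sets of its proper faces. -}

module Defs where

open import Data.Nat using (ℕ; zero; suc; _∸_)
open import Data.Fin using (Fin; toℕ)
open import Data.Bool using (Bool; true; false)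
open import Data.List using (List; []; _∷_; map; _++_; foldr)
open import Data.List.Base using (allFin)
open import Data.Rational using (ℚ; 0ℚ; 1ℚ; _+_; _*_; _≤_)
open import Data.Product using (Σ; _×_; ∃; ∃-syntax; _,_)
open import Data.Sum using (_⊎_)
open import Relation.Nullary using (¬_)
open import Relation.Binary.PropositionalEquality using (_≡_)
open import Function.Bundles using (_⇔_)

-- The graphs G_m  (indices are 0-based:  a i  stands for a_{i+1},
-- b i for b_{i+1}, and  c j  (j : Fin (m ∸ 1)) stands for c_{j+2}).

data Vtx (m : ℕ) : Set where
  a : Fin m → Vtx m
  b : Fin m → Vtx m
  c : Fin (m ∸ 1) → Vtx m

-- Directed list of the edges of G_m (0-based indices, k = new index):
--   a_k b_k ;  a_{k-1} a_k ;  b_{k-1} c_k ;  b_k c_k ;  c_{k-1} a_k (k ≥ 2)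
-- where c j has 0-based index toℕ j + 1.
data Edge {m : ℕ} : Vtx m → Vtx m → Set where
  ab : (i j : Fin m) → toℕ i ≡ toℕ j → Edge (a i) (b j)
  aa : (i j : Fin m) → suc (toℕ i) ≡ toℕ j → Edge (a i) (a j)
  bc₁ : (i : Fin m) (j : Fin (m ∸ 1)) → toℕ i ≡ toℕ j → Edge (b i) (c j)
  bc₂ : (i : Fin m) (j : Fin (m ∸ 1)) → toℕ i ≡ suc (toℕ j) → Edge (b i) (c j)
  ca : (j : Fin (m ∸ 1)) (i : Fin m) → toℕ i ≡ suc (suc (toℕ j)) → Edge (c j) (a i)

Adj : (m : ℕ) → Vtx m → Vtx m → Set
Adj m u v = Edge u v ⊎ Edge v u

allVtx : (m : ℕ) → List (Vtx m)
allVtx m = map a (allFin m) ++ (map b (allFin m) ++ map c (allFin (m ∸ 1)))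

Subset : ℕ → Set
Subset m = Vtx m → Bool

IndFace : (m : ℕ) → Subset m → Set
IndFace m S = ∀ u v → S u ≡ true → S v ≡ true → ¬ Adj m u v

Pt : ℕ → Set
Pt d = Fin d → ℚ

sumFin : (d : ℕ) → (Fin d → ℚ) → ℚ
sumFin zero    f = 0ℚ
sumFin (suc d) f = f Fin.zero + sumFin d (λ i → f (Fin.suc i))

_·_ : {d : ℕ} → Pt d → Pt d → ℚ
_·_ {d} x y = sumFin d (λ i → x i * y i)

sumList : {A : Set} → List A → (A → ℚ) → ℚ
sumList xs f = foldr (λ x r → f x + r) 0ℚ xs

-- Polytope P = conv { p v : v a vertex } in ℚ^d, p : Vtx m → Pt d.

ProperFaceSet : {m d : ℕ} → (Vtx m → Pt d) → Subset m → Set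
ProperFaceSet {m} {d} p S =
  (Σ (Pt d) λ α → Σ ℚ λ β →
     (∀ v → (α · p v) ≤ β) × (∀ v → ((α · p v) ≡ β) ⇔ (S v ≡ true)))
  × ¬ (∀ v → S v ≡ true)

-- P is full-dimensional (dimension d): the points lie in no affine
-- hyperplane, i.e. a functional constant on all points is zero.
FullDim : {m d : ℕ} → (Vtx m → Pt d) → Set
FullDim {m} {d} p =
  ∀ (α : Pt d) (β : ℚ) → (∀ v → (α · p v) ≡ β) → ∀ i → α i ≡ 0ℚ

AffIndep : {m d : ℕ} → (Vtx m → Pt d) → Subset m → Set
AffIndep {m} {d} p S =
  ∀ (λ′ : Vtx m → ℚ) → (∀ v → S v ≡ false → λ′ v ≡ 0ℚ) →
    sumList (allVtx m) λ′ ≡ 0ℚ →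
    (∀ i → sumList (allVtx m) (λ v → λ′ v * p v i) ≡ 0ℚ) →
    ∀ v → λ′ v ≡ 0ℚ

Simplicial : {m d : ℕ} → (Vtx m → Pt d) → Set
Simplicial p = ∀ S → ProperFaceSet p S → AffIndep p S

-- A simplicial complex on Vtx m (given by its faces) is combinatorially
-- equivalent to the boundary complex of a simplicial d-polytope: there is
-- a labelling p of its vertices by points of ℚ^d whose convex hull is a
-- d-dimensional simplicial polytope whose proper faces have exactly the
-- vertex sets { p v : v ∈ S } for S a face of the complex.
IsSimplicialPolytopeBoundary : (m d : ℕ) → (Subset m → Set) → Set
IsSimplicialPolytopeBoundary m d Face =
  Σ (Vtx m → Pt d) λ p →
    FullDim p × Simplicial p × (∀ S → Face S ⇔ ProperFaceSet p S)

{-# OPTIONS --safe #-}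
module Submission where

-- Realise the vertices in ℚ^m by a_k ↦ −e_k, b_k ↦ e_k and c_k ↦ −e_k − ½e_{k−1} (paper's indexing).
--
-- If a valid inequality α·x ≤ β is tight at both ends of an edge of G_m, a linear relation
-- among at most four of the points forces β ≤ 0; since all ±e_k are points, this gives α = 0
-- and β = 0, so the inequality defines no proper face. Hence proper faces are independent sets.
--
-- Conversely, an independent set S is cut out by α·x ≤ 1 where α is built coordinate by
-- coordinate: α_k = 1 if b_k ∈ S, −1 if a_k ∈ S, −1 − ½α_{k−1} if c_k ∈ S, and otherwise a
-- value in (−½, ½] chosen by looking ahead at a_{k+1} and c_{k+1}. An invariant on α_{k−1}
-- keeps every vertex outside S strictly below 1.
--
-- Independent sets stay independent when a vertex is deleted, so every vertex of a face is
-- separated from the rest of the face by a supporting hyperplane: each face is a simplex.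

open import Defs
open import Algebra.Bundles using (CommutativeMonoid; CommutativeRing)
open import Data.Bool using (Bool; true; false; _∧_; if_then_else_)
open import Data.Bool.Properties using (∧-zeroʳ)
open import Data.Empty using (⊥; ⊥-elim)
open import Data.Fin as Fin using (Fin; toℕ; fromℕ<; punchIn)
open import Data.Fin.Properties using (toℕ-fromℕ<; toℕ<n; punchInᵢ≢i)
open import Data.List using (List; []; _∷_; map; _++_; tabulate; allFin)
open import Data.List.Properties using (map-tabulate)
open import Data.Nat as ℕ using (ℕ; zero; suc; _≥_; _≡ᵇ_; s<s)
import Data.Nat.Properties as ℕₚ
open import Data.Product using (Σ-syntax; _×_; _,_; proj₁; proj₂)
open import Data.Rational
  using (ℚ; 0ℚ; 1ℚ; ½; -½; _+_; _*_; _-_; -_; 1/_; _≤_; _<_; _≤?_; _<?_; positive; NonZero; ≢-nonZero)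
open import Data.Rational.Properties hiding (_≟_)
open import Data.Rational.Solver using (module +-*-Solver)
open import Data.Sum using (_⊎_; inj₁; inj₂; [_,_])
open import Function.Base using (_∘_)
open import Function.Bundles using (_⇔_; mk⇔; Equivalence)
open import Relation.Nullary using (Dec; yes; no; does)
open import Relation.Nullary.Decidable using (True; toWitness; map′)
open import Relation.Binary.PropositionalEquality
  using (_≡_; _≢_; refl; sym; trans; cong; cong₂; subst; module ≡-Reasoning)

open import Algebra.Properties.Group +-0-group
  using () renaming (⁻¹-involutive to neg-involutive; x∙y⁻¹≈ε⇒x≈y to p-q≡0⇒p≡q)
open import Algebra.Properties.CommutativeSemigroup (CommutativeMonoid.commutativeSemigroup *-1-commutativeMonoid)
  using (x∙yz≈y∙xz)
open import Algebra.Properties.Semiring.Sum (CommutativeRing.semiring +-*-commutativeRing)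
  using (sum; sum-cong-≗; ∑-distrib-+; *-distribˡ-sum; sum-remove; sum-replicate-zero)
open +-*-Solver
open Equivalence

decide-< : ∀ {p q} {p<q : True (p <? q)} → p < q
decide-< {p<q = p<q} = toWitness p<q

decide-≤ : ∀ {p q} {p≤q : True (p ≤? q)} → p ≤ q
decide-≤ {p≤q = p≤q} = toWitness p≤q

zero-product : ∀ {x y} → x * y ≡ 0ℚ → y ≢ 0ℚ → x ≡ 0ℚ
zero-product {x} {y} xy≡0 y≢0 = begin
  x                ≡⟨ *-identityʳ x ⟨
  x * 1ℚ           ≡⟨ cong (x *_) (*-inverseʳ y) ⟨
  x * (y * 1/ y)   ≡⟨ *-assoc x y (1/ y) ⟨
  x * y * 1/ y     ≡⟨ cong (_* 1/ y) xy≡0 ⟩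
  0ℚ * 1/ y        ≡⟨ *-zeroˡ (1/ y) ⟩
  0ℚ               ∎
  where
  open ≡-Reasoning
  instance
    y-nonZero : NonZero y
    y-nonZero = ≢-nonZero y≢0

opposite⇒zero : ∀ {x β} → - x ≡ β → x ≡ β → x ≡ 0ℚ
opposite⇒zero {x} {β} -x≡β x≡β = begin
  x              ≡⟨ solve 1 (λ x → x := con ½ :* (x :- :- x)) refl x ⟩
  ½ * (x - - x)  ≡⟨ cong₂ (λ u w → ½ * (u - w)) x≡β -x≡β ⟩
  ½ * (β - β)    ≡⟨ cong (½ *_) (+-inverseʳ β) ⟩
  0ℚ             ∎
  where open ≡-Reasoning

≤-multiples⇒nonPos : ∀ {q r β} → r < q → q * β ≤ r * β → β ≤ 0ℚ
≤-multiples⇒nonPos {q} {r} {β} r<q qβ≤rβ =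
  ≮⇒≥ λ 0<β → <-irrefl refl (≤-<-trans qβ≤rβ (*-monoˡ-<-pos β {{positive 0<β}} r<q))

squeeze : ∀ {y β} → - y ≤ β → y ≤ β → β ≤ 0ℚ → y ≡ 0ℚ × β ≡ 0ℚ
squeeze {y} {β} -y≤β y≤β β≤0 = y≡0 , ≤-antisym β≤0 (subst (_≤ β) (cong -_ y≡0) -y≤β)
  where
  y≡0 : y ≡ 0ℚ
  y≡0 = ≤-antisym (≤-trans y≤β β≤0) (subst (0ℚ ≤_) (neg-involutive y) (neg-antimono-≤ (≤-trans -y≤β β≤0)))

sumFin≡sum : ∀ d (f : Fin d → ℚ) → sumFin d f ≡ sum f
sumFin≡sum zero    f = refl
sumFin≡sum (suc d) f = cong (f Fin.zero +_) (sumFin≡sum d (f ∘ Fin.suc))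

sum-zero : ∀ {n} (t : Fin n → ℚ) → (∀ i → t i ≡ 0ℚ) → sum t ≡ 0ℚ
sum-zero {n} t t≡0 = trans (sum-cong-≗ t≡0) (sum-replicate-zero n)

sum-δ : ∀ {n} (t : Fin n → ℚ) i → (∀ j → j ≢ i → t j ≡ 0ℚ) → sum t ≡ t i
sum-δ {suc n} t i t≡0 = begin
  sum t                      ≡⟨ sum-remove {i = i} t ⟩
  t i + sum (t ∘ punchIn i)  ≡⟨ cong (t i +_) (sum-zero _ (λ j → t≡0 _ (punchInᵢ≢i i j))) ⟩
  t i + 0ℚ                   ≡⟨ +-identityʳ (t i) ⟩
  t i                        ∎
  where open ≡-Reasoning

·≡sum : ∀ {d} (α x : Pt d) → α · x ≡ sum (λ i → α i * x i)
·≡sum {d} α x = sumFin≡sum d _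

·-vanishes : ∀ {d} (α x : Pt d) → (∀ i → x i ≡ 0ℚ) → α · x ≡ 0ℚ
·-vanishes α x x≡0 = trans (·≡sum α x) (sum-zero _ (λ i → trans (cong (α i *_) (x≡0 i)) (*-zeroʳ (α i))))

·-distribˡ-+ : ∀ {d} (α x y : Pt d) → α · (λ i → x i + y i) ≡ α · x + α · y
·-distribˡ-+ α x y = begin
  α · (λ i → x i + y i)                           ≡⟨ ·≡sum α _ ⟩
  sum (λ i → α i * (x i + y i))                   ≡⟨ sum-cong-≗ (λ i → *-distribˡ-+ (α i) (x i) (y i)) ⟩
  sum (λ i → α i * x i + α i * y i)               ≡⟨ ∑-distrib-+ (λ i → α i * x i) (λ i → α i * y i) ⟩
  sum (λ i → α i * x i) + sum (λ i → α i * y i)   ≡⟨ sym (cong₂ _+_ (·≡sum α x) (·≡sum α y)) ⟩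
  α · x + α · y                                   ∎
  where open ≡-Reasoning

·-scaleʳ : ∀ {d} (α x : Pt d) q → α · (λ i → q * x i) ≡ q * (α · x)
·-scaleʳ α x q = begin
  α · (λ i → q * x i)          ≡⟨ ·≡sum α _ ⟩
  sum (λ i → α i * (q * x i))  ≡⟨ sum-cong-≗ (λ i → x∙yz≈y∙xz (α i) q (x i)) ⟩
  sum (λ i → q * (α i * x i))  ≡⟨ sym (*-distribˡ-sum q (λ i → α i * x i)) ⟩
  q * sum (λ i → α i * x i)    ≡⟨ cong (q *_) (sym (·≡sum α x)) ⟩
  q * (α · x)                  ∎
  where open ≡-Reasoning

sumList-++ : ∀ {A : Set} (xs ys : List A) t → sumList (xs ++ ys) t ≡ sumList xs t + sumList ys t
sumList-++ []       ys t = sym (+-identityˡ _)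
sumList-++ (x ∷ xs) ys t = trans (cong (t x +_) (sumList-++ xs ys t)) (sym (+-assoc (t x) _ _))

sumList-tabulate : ∀ {A : Set} {n} (f : Fin n → A) t → sumList (tabulate f) t ≡ sum (t ∘ f)
sumList-tabulate {n = zero}  f t = refl
sumList-tabulate {n = suc n} f t = cong (t (f Fin.zero) +_) (sumList-tabulate (f ∘ Fin.suc) t)

sumList-map-allFin : ∀ {A : Set} {n} (f : Fin n → A) t → sumList (map f (allFin n)) t ≡ sum (t ∘ f)
sumList-map-allFin f t = trans (cong (λ xs → sumList xs t) (map-tabulate (λ i → i) f)) (sumList-tabulate f t)

sumList-affine : ∀ {A : Set} {d} (xs : List A) (λ′ : A → ℚ) (p : A → Pt d) (α : Pt d) β →
  sumList xs (λ w → λ′ w * (α · p w - β)) ≡ α · (λ i → sumList xs (λ w → λ′ w * p w i)) - β * sumList xs λ′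
sumList-affine []       λ′ p α β = sym (cong₂ _-_ (·-vanishes α _ λ _ → refl) (*-zeroʳ β))
sumList-affine {d = d} (x ∷ xs) λ′ p α β = begin
  λ′ x * (α · p x - β) + sumList xs (λ w → λ′ w * (α · p w - β))
    ≡⟨ cong (λ′ x * (α · p x - β) +_) (sumList-affine xs λ′ p α β) ⟩
  λ′ x * (α · p x - β) + (α · P - β * L)
    ≡⟨ solve 5 (λ l u β w L → l :* (u :- β) :+ (w :- β :* L) := (l :* u :+ w) :- β :* (l :+ L))
               refl (λ′ x) (α · p x) β (α · P) L ⟩
  (λ′ x * (α · p x) + α · P) - β * (λ′ x + L)
    ≡⟨ cong (λ s → s - β * (λ′ x + L))
            (trans (·-distribˡ-+ α _ P) (cong (_+ α · P) (·-scaleʳ α (p x) (λ′ x)))) ⟨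
  α · (λ i → λ′ x * p x i + P i) - β * (λ′ x + L) ∎
  where
  open ≡-Reasoning
  P : Pt d
  P i = sumList xs (λ w → λ′ w * p w i)
  L : ℚ
  L = sumList xs λ′

extend : ∀ {A : Set} {d} → A → (Fin d → A) → ℕ → A
extend {d = zero}  z f n       = z
extend {d = suc d} z f zero    = f Fin.zero
extend {d = suc d} z f (suc n) = extend z (f ∘ Fin.suc) n

extend-toℕ : ∀ {A : Set} {d} (z : A) (f : Fin d → A) i → extend z f (toℕ i) ≡ f i
extend-toℕ z f Fin.zero    = refl
extend-toℕ z f (Fin.suc i) = extend-toℕ z (f ∘ Fin.suc) i

extend-∘toℕ : ∀ {A : Set} {d} (z : A) (g : ℕ → A) {n} → n ℕ.< d → extend {d = d} z (g ∘ toℕ) n ≡ g n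
extend-∘toℕ {A} {d} z g {n} n<d = begin
  extend z gᵈ n                   ≡⟨ cong (extend z gᵈ) (sym (toℕ-fromℕ< n<d)) ⟩
  extend z gᵈ (toℕ (fromℕ< n<d))  ≡⟨ extend-toℕ z gᵈ (fromℕ< n<d) ⟩
  g (toℕ (fromℕ< n<d))            ≡⟨ cong g (toℕ-fromℕ< n<d) ⟩
  g n                             ∎
  where
  open ≡-Reasoning
  gᵈ : Fin d → A
  gᵈ = g ∘ toℕ

extend-witness : ∀ {d} (f : Fin d → Bool) {n} → extend false f n ≡ true → Σ[ i ∈ Fin d ] toℕ i ≡ n × f i ≡ true
extend-witness {zero}  f ()
extend-witness {suc d} f {zero}  f₀ = Fin.zero , refl , f₀
extend-witness {suc d} f {suc n} fₙ with extend-witness (f ∘ Fin.suc) fₙ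
... | i , refl , fᵢ = Fin.suc i , refl , fᵢ

coord : ∀ {d} → Pt d → ℕ → ℚ
coord = extend 0ℚ

infix 7 _⋆e_
_⋆e_ : ∀ {d} → ℚ → ℕ → Pt d
(q ⋆e n) k = if toℕ k ≡ᵇ n then q else 0ℚ

·-⋆e : ∀ {d} (α : Pt d) q n → α · (q ⋆e n) ≡ coord α n * q
·-⋆e {zero}  α q n       = sym (*-zeroˡ q)
·-⋆e {suc d} α q zero    =
  trans (cong (α Fin.zero * q +_) (·-vanishes (α ∘ Fin.suc) _ (λ _ → refl))) (+-identityʳ _)
·-⋆e {suc d} α q (suc n) =
  trans (cong₂ _+_ (*-zeroʳ (α Fin.zero)) (·-⋆e (α ∘ Fin.suc) q n)) (+-identityˡ _)

-- A criterion for simpliciality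

_≟_ : ∀ {m} (u v : Vtx m) → Dec (u ≡ v)
a i ≟ a j = map′ (cong a) (λ { refl → refl }) (i Fin.≟ j)
b i ≟ b j = map′ (cong b) (λ { refl → refl }) (i Fin.≟ j)
c i ≟ c j = map′ (cong c) (λ { refl → refl }) (i Fin.≟ j)
a _ ≟ b _ = no λ ()
a _ ≟ c _ = no λ ()
b _ ≟ a _ = no λ ()
b _ ≟ c _ = no λ ()
c _ ≟ a _ = no λ ()
c _ ≟ b _ = no λ ()

delete : ∀ {m} → Vtx m → Subset m → Subset m
delete v S w = if does (w ≟ v) then false else S w

delete-self : ∀ {m} (v : Vtx m) S → delete v S v ≡ false
delete-self v S with v ≟ v
... | yes _   = refl
... | no v≢v = ⊥-elim (v≢v refl)

delete-other : ∀ {m} {v w : Vtx m} S → w ≢ v → delete v S w ≡ S w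
delete-other {v = v} {w} S w≢v with w ≟ v
... | yes w≡v = ⊥-elim (w≢v w≡v)
... | no _    = refl

delete-⊆ : ∀ {m} {v w : Vtx m} S → delete v S w ≡ true → S w ≡ true
delete-⊆ {v = v} {w} S w∈S-v with w ≟ v
... | no _ = w∈S-v

sumList-allVtx : ∀ {m} (t : Vtx m → ℚ) → sumList (allVtx m) t ≡ sum (t ∘ a) + (sum (t ∘ b) + sum (t ∘ c))
sumList-allVtx t = trans (sumList-++ (map a (allFin _)) _ t)
  (cong₂ _+_ (sumList-map-allFin a t)
    (trans (sumList-++ (map b (allFin _)) _ t) (cong₂ _+_ (sumList-map-allFin b t) (sumList-map-allFin c t))))

sumList-allVtx-δ : ∀ {m} (t : Vtx m → ℚ) v → (∀ w → w ≢ v → t w ≡ 0ℚ) → sumList (allVtx m) t ≡ t v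
sumList-allVtx-δ t v t≡0 = trans (sumList-allVtx t) (blocks v t≡0)
  where
  open ≡-Reasoning
  blocks : ∀ v → (∀ w → w ≢ v → t w ≡ 0ℚ) → sum (t ∘ a) + (sum (t ∘ b) + sum (t ∘ c)) ≡ t v
  blocks (a i) t≡0 = begin
    sum (t ∘ a) + (sum (t ∘ b) + sum (t ∘ c))
      ≡⟨ cong₂ _+_ (sum-δ (t ∘ a) i λ j j≢i → t≡0 (a j) λ { refl → j≢i refl })
                   (cong₂ _+_ (sum-zero (t ∘ b) λ j → t≡0 (b j) λ ()) (sum-zero (t ∘ c) λ j → t≡0 (c j) λ ())) ⟩
    t (a i) + 0ℚ
      ≡⟨ +-identityʳ (t (a i)) ⟩
    t (a i) ∎
  blocks (b i) t≡0 = begin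
    sum (t ∘ a) + (sum (t ∘ b) + sum (t ∘ c))
      ≡⟨ cong₂ _+_ (sum-zero (t ∘ a) λ j → t≡0 (a j) λ ())
                   (cong₂ _+_ (sum-δ (t ∘ b) i λ j j≢i → t≡0 (b j) λ { refl → j≢i refl })
                              (sum-zero (t ∘ c) λ j → t≡0 (c j) λ ())) ⟩
    0ℚ + (t (b i) + 0ℚ)
      ≡⟨ trans (+-identityˡ _) (+-identityʳ (t (b i))) ⟩
    t (b i) ∎
  blocks (c i) t≡0 = begin
    sum (t ∘ a) + (sum (t ∘ b) + sum (t ∘ c))
      ≡⟨ cong₂ _+_ (sum-zero (t ∘ a) λ j → t≡0 (a j) λ ())
                   (cong₂ _+_ (sum-zero (t ∘ b) λ j → t≡0 (b j) λ ())
                              (sum-δ (t ∘ c) i λ j j≢i → t≡0 (c j) λ { refl → j≢i refl })) ⟩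
    0ℚ + (0ℚ + t (c i))
      ≡⟨ trans (+-identityˡ _) (+-identityˡ (t (c i))) ⟩
    t (c i) ∎

separated⇒coefficient-zero : ∀ {m d} (p : Vtx m → Pt d) (λ′ : Vtx m → ℚ) (α : Pt d) β v →
  sumList (allVtx m) λ′ ≡ 0ℚ → (∀ i → sumList (allVtx m) (λ w → λ′ w * p w i) ≡ 0ℚ) →
  (∀ w → w ≢ v → λ′ w ≡ 0ℚ ⊎ α · p w ≡ β) → α · p v ≢ β → λ′ v ≡ 0ℚ
separated⇒coefficient-zero {m} p λ′ α β v Σλ≡0 Σλp≡0 others α·pᵥ≢β =
  zero-product term-v≡0 (α·pᵥ≢β ∘ p-q≡0⇒p≡q (α · p v) β)
  where
  open ≡-Reasoning
  term : Vtx m → ℚ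
  term w = λ′ w * (α · p w - β)
  term-vanishes : ∀ w → w ≢ v → term w ≡ 0ℚ
  term-vanishes w w≢v with others w w≢v
  ... | inj₁ λ′w≡0 = trans (cong (_* (α · p w - β)) λ′w≡0) (*-zeroˡ (α · p w - β))
  ... | inj₂ α·p≡β =
    trans (cong (λ s → λ′ w * (s - β)) α·p≡β) (trans (cong (λ′ w *_) (+-inverseʳ β)) (*-zeroʳ (λ′ w)))
  term-v≡0 : term v ≡ 0ℚ
  term-v≡0 = begin
    term v                          ≡⟨ sumList-allVtx-δ term v term-vanishes ⟨
    sumList (allVtx m) term         ≡⟨ sumList-affine (allVtx m) λ′ p α β ⟩
    α · (λ i → sumList (allVtx m) (λ w → λ′ w * p w i)) - β * sumList (allVtx m) λ′
                                    ≡⟨ cong₂ (λ s t → s - β * t) (·-vanishes α _ Σλp≡0) Σλ≡0 ⟩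
    0ℚ - β * 0ℚ                     ≡⟨ cong (λ t → 0ℚ - t) (*-zeroʳ β) ⟩
    0ℚ                              ∎

simplicial-if-deletion-closed : ∀ {m d} (p : Vtx m → Pt d) →
  (∀ S v → ProperFaceSet p S → S v ≡ true → ProperFaceSet p (delete v S)) → Simplicial p
simplicial-if-deletion-closed p deletion-closed S face λ′ λ′-on-S Σλ≡0 Σλp≡0 v with S v in Sᵥ
... | false = λ′-on-S v Sᵥ
... | true  with deletion-closed S v face Sᵥ
...   | (α , β , _ , tight⇔S-v) , _ =
  separated⇒coefficient-zero p λ′ α β v Σλ≡0 Σλp≡0 others
    (λ α·pᵥ≡β → false≢true (trans (sym (delete-self v S)) (to (tight⇔S-v v) α·pᵥ≡β)))
  where
  false≢true : false ≢ true
  false≢true ()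
  others : ∀ w → w ≢ v → λ′ w ≡ 0ℚ ⊎ α · p w ≡ β
  others w w≢v with S w in S_w
  ... | false = inj₁ (λ′-on-S w S_w)
  ... | true  = inj₂ (from (tight⇔S-v w) (trans (delete-other S w≢v) S_w))

point : ∀ {m} → Vtx m → Pt m
point (a i) = - 1ℚ ⋆e toℕ i
point (b i) = 1ℚ ⋆e toℕ i
point (c j) = λ k → (- 1ℚ ⋆e suc (toℕ j)) k + (-½ ⋆e toℕ j) k

value : ∀ {m} → (ℕ → ℚ) → Vtx m → ℚ
value x (a i) = - x (toℕ i)
value x (b i) = x (toℕ i)
value x (c j) = - x (suc (toℕ j)) - ½ * x (toℕ j)

·-point : ∀ {m} (α : Pt m) v → α · point v ≡ value (coord α) v
·-point α (a i) = trans (·-⋆e α (- 1ℚ) (toℕ i)) (solve 1 (λ y → y :* (:- con 1ℚ) := :- y) refl _)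
·-point α (b i) = trans (·-⋆e α 1ℚ (toℕ i)) (*-identityʳ _)
·-point α (c j) = begin
  α · point (c j)                                       ≡⟨ ·-distribˡ-+ α _ _ ⟩
  α · (- 1ℚ ⋆e suc (toℕ j)) + α · (-½ ⋆e toℕ j)         ≡⟨ cong₂ _+_ (·-⋆e α _ _) (·-⋆e α _ _) ⟩
  coord α (suc (toℕ j)) * - 1ℚ + coord α (toℕ j) * -½
    ≡⟨ solve 2 (λ y z → y :* (:- con 1ℚ) :+ z :* con -½ := :- y :- con ½ :* z)
               refl (coord α (suc (toℕ j))) (coord α (toℕ j)) ⟩
  - coord α (suc (toℕ j)) - ½ * coord α (toℕ j)         ∎
  where open ≡-Reasoning

value-cong : ∀ {m} {x y : ℕ → ℚ} → (∀ {n} → n ℕ.< suc m → x n ≡ y n) → (v : Vtx (suc m)) → value x v ≡ value y v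
value-cong x≡y (a i) = cong -_ (x≡y (toℕ<n i))
value-cong x≡y (b i) = x≡y (toℕ<n i)
value-cong x≡y (c j) = cong₂ (λ u w → - u - ½ * w) (x≡y (s<s (toℕ<n j))) (x≡y (ℕₚ.m<n⇒m<1+n (toℕ<n j)))

value-zero : ∀ {m} (v : Vtx m) → value (λ _ → 0ℚ) v ≡ 0ℚ
value-zero (a i) = refl
value-zero (b i) = refl
value-zero (c j) = refl

point-fullDim : ∀ {m} → FullDim (point {m})
point-fullDim α β constant i = begin
  α i              ≡⟨ sym (extend-toℕ 0ℚ α i) ⟩
  coord α (toℕ i)  ≡⟨ opposite⇒zero (value≡β (a i)) (value≡β (b i)) ⟩
  0ℚ               ∎
  where
  open ≡-Reasoning
  value≡β : ∀ v → value (coord α) v ≡ β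
  value≡β v = trans (sym (·-point α v)) (constant v)

-- Proper faces are independent sets

ab-tight⇒nonPos : ∀ {x β} → - x ≡ β → x ≡ β → β ≤ 0ℚ
ab-tight⇒nonPos {x} -x≡β x≡β = ≤-reflexive (trans (sym x≡β) (opposite⇒zero -x≡β x≡β))

aa-tight⇒nonPos : ∀ {x y β} → - x ≡ β → - y ≡ β → - y - ½ * x ≤ β → β ≤ 0ℚ
aa-tight⇒nonPos {x} {y} {β} -x≡β -y≡β c≤β = ≤-multiples⇒nonPos {1ℚ + ½} {1ℚ} decide-< (begin
  (1ℚ + ½) * β   ≡⟨ solve 1 (λ β → (con 1ℚ :+ con ½) :* β := β :+ con ½ :* β) refl β ⟩
  β + ½ * β      ≡⟨ cong₂ (λ u w → u + ½ * w) (sym -y≡β) (sym -x≡β) ⟩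
  - y + ½ * - x  ≡⟨ solve 2 (λ x y → :- y :+ con ½ :* (:- x) := :- y :- con ½ :* x) refl x y ⟩
  - y - ½ * x    ≤⟨ c≤β ⟩
  β              ≡⟨ *-identityˡ β ⟨
  1ℚ * β         ∎)
  where open ≤-Reasoning

bc₁-tight⇒nonPos : ∀ {x y β} → x ≡ β → - y - ½ * x ≡ β → - y ≤ β → β ≤ 0ℚ
bc₁-tight⇒nonPos {x} {y} {β} x≡β c≡β -y≤β = ≤-multiples⇒nonPos {1ℚ + ½} {1ℚ} decide-< (begin
  (1ℚ + ½) * β         ≡⟨ solve 1 (λ β → (con 1ℚ :+ con ½) :* β := β :+ con ½ :* β) refl β ⟩
  β + ½ * β            ≡⟨ cong₂ (λ u w → u + ½ * w) (sym c≡β) (sym x≡β) ⟩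
  - y - ½ * x + ½ * x  ≡⟨ solve 2 (λ x y → :- y :- con ½ :* x :+ con ½ :* x := :- y) refl x y ⟩
  - y                  ≤⟨ -y≤β ⟩
  β                    ≡⟨ *-identityˡ β ⟨
  1ℚ * β               ∎)
  where open ≤-Reasoning

bc₂-tight⇒nonPos : ∀ {x y β} → y ≡ β → - y - ½ * x ≡ β → - x ≤ β → β ≤ 0ℚ
bc₂-tight⇒nonPos {x} {y} {β} y≡β c≡β -x≤β = ≤-multiples⇒nonPos {1ℚ + 1ℚ} {½} decide-< (begin
  (1ℚ + 1ℚ) * β    ≡⟨ solve 1 (λ β → (con 1ℚ :+ con 1ℚ) :* β := β :+ β) refl β ⟩
  β + β            ≡⟨ cong₂ _+_ (sym c≡β) (sym y≡β) ⟩
  - y - ½ * x + y  ≡⟨ solve 2 (λ x y → :- y :- con ½ :* x :+ y := con ½ :* (:- x)) refl x y ⟩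
  ½ * - x          ≤⟨ *-monoˡ-≤-nonNeg ½ -x≤β ⟩
  ½ * β            ∎)
  where open ≤-Reasoning

ca-tight⇒nonPos : ∀ {x y z β} → - y - ½ * x ≡ β → - z ≡ β → - z - ½ * y ≤ β → - x ≤ β → β ≤ 0ℚ
ca-tight⇒nonPos {x} {y} {z} {β} c≡β -z≡β c′≤β -x≤β = ≤-multiples⇒nonPos {1ℚ + ½} {1ℚ + ½ * ½} decide-< (begin
  (1ℚ + ½) * β                    ≡⟨ solve 1 (λ β → (con 1ℚ :+ con ½) :* β := β :+ con ½ :* β) refl β ⟩
  β + ½ * β                       ≡⟨ cong₂ (λ u w → u + ½ * w) (sym -z≡β) (sym c≡β) ⟩
  - z + ½ * (- y - ½ * x)
    ≡⟨ solve 3 (λ x y z → :- z :+ con ½ :* (:- y :- con ½ :* x)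
                      := (:- z :- con ½ :* y) :+ con ½ :* (con ½ :* (:- x))) refl x y z ⟩
  (- z - ½ * y) + ½ * (½ * - x)   ≤⟨ +-mono-≤ c′≤β (*-monoˡ-≤-nonNeg ½ (*-monoˡ-≤-nonNeg ½ -x≤β)) ⟩
  β + ½ * (½ * β)
    ≡⟨ solve 1 (λ β → β :+ con ½ :* (con ½ :* β) := (con 1ℚ :+ con ½ :* con ½) :* β) refl β ⟩
  (1ℚ + ½ * ½) * β                ∎)
  where open ≤-Reasoning

module ValidInequality {m} (x : ℕ → ℚ) (β : ℚ) (valid : ∀ (v : Vtx (suc m)) → value x v ≤ β) where

  a-valid : ∀ {n} → n ℕ.< suc m → - x n ≤ β
  a-valid n<m = subst (λ k → - x k ≤ β) (toℕ-fromℕ< n<m) (valid (a (fromℕ< n<m)))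

  b-valid : ∀ {n} → n ℕ.< suc m → x n ≤ β
  b-valid n<m = subst (λ k → x k ≤ β) (toℕ-fromℕ< n<m) (valid (b (fromℕ< n<m)))

  c-valid : ∀ {n} → n ℕ.< m → - x (suc n) - ½ * x n ≤ β
  c-valid n<m = subst (λ k → - x (suc k) - ½ * x k ≤ β) (toℕ-fromℕ< n<m) (valid (c (fromℕ< n<m)))

  edge-tight⇒nonPos : ∀ {u v} → Edge u v → value x u ≡ β → value x v ≡ β → β ≤ 0ℚ
  edge-tight⇒nonPos (ab i j i≡j) u≡β v≡β =
    ab-tight⇒nonPos u≡β (subst (λ k → x k ≡ β) (sym i≡j) v≡β)
  edge-tight⇒nonPos (aa i j 1+i≡j) u≡β v≡β =
    aa-tight⇒nonPos u≡β (subst (λ k → - x k ≡ β) (sym 1+i≡j) v≡β)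
      (c-valid (ℕ.s<s⁻¹ (subst (ℕ._< suc m) (sym 1+i≡j) (toℕ<n j))))
  edge-tight⇒nonPos (bc₁ i j i≡j) u≡β v≡β =
    bc₁-tight⇒nonPos (subst (λ k → x k ≡ β) i≡j u≡β) v≡β (a-valid (s<s (toℕ<n j)))
  edge-tight⇒nonPos (bc₂ i j i≡1+j) u≡β v≡β =
    bc₂-tight⇒nonPos (subst (λ k → x k ≡ β) i≡1+j u≡β) v≡β (a-valid (ℕₚ.m<n⇒m<1+n (toℕ<n j)))
  edge-tight⇒nonPos (ca j i i≡2+j) u≡β v≡β =
    ca-tight⇒nonPos {x (toℕ j)} {x (suc (toℕ j))} u≡β (subst (λ k → - x k ≡ β) i≡2+j v≡β)
      (c-valid (ℕ.s<s⁻¹ (subst (ℕ._< suc m) i≡2+j (toℕ<n i))))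
      (a-valid (ℕₚ.m<n⇒m<1+n (toℕ<n j)))

  nonPos⇒tight : β ≤ 0ℚ → ∀ v → value x v ≡ β
  nonPos⇒tight β≤0 v = begin
    value x v            ≡⟨ value-cong (proj₁ ∘ zero-at) v ⟩
    value (λ _ → 0ℚ) v   ≡⟨ value-zero v ⟩
    0ℚ                   ≡⟨ proj₂ (zero-at (s<s ℕ.z≤n)) ⟨
    β                    ∎
    where
    open ≡-Reasoning
    zero-at : ∀ {n} → n ℕ.< suc m → x n ≡ 0ℚ × β ≡ 0ℚ
    zero-at n<m = squeeze (a-valid n<m) (b-valid n<m) β≤0

face⇒independent : ∀ {m} S → ProperFaceSet (point {suc m}) S → IndFace (suc m) S
face⇒independent S ((α , β , valid , tight⇔S) , proper) u v u∈S v∈S u~v =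
  proper λ w → to (tight⇔S w) (trans (·-point α w) (nonPos⇒tight β≤0 w))
  where
  open ValidInequality (coord α) β (λ w → subst (_≤ β) (·-point α w) (valid w))
  S⇒tight : ∀ {w} → S w ≡ true → value (coord α) w ≡ β
  S⇒tight {w} w∈S = trans (sym (·-point α w)) (from (tight⇔S w) w∈S)
  β≤0 : β ≤ 0ℚ
  β≤0 = [ (λ u→v → edge-tight⇒nonPos u→v (S⇒tight u∈S) (S⇒tight v∈S))
        , (λ v→u → edge-tight⇒nonPos v→u (S⇒tight v∈S) (S⇒tight u∈S)) ] u~v

-- Independent sets are proper faces

Tight : ℚ → Bool → Set
Tight v s = v ≤ 1ℚ × ((v ≡ 1ℚ) ⇔ (s ≡ true))

tight : ∀ {v} → v ≡ 1ℚ → Tight v true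
tight v≡1 = ≤-reflexive v≡1 , mk⇔ (λ _ → refl) (λ _ → v≡1)

slack : ∀ {v} → v < 1ℚ → Tight v false
slack v<1 = <⇒≤ v<1 , mk⇔ (λ v≡1 → ⊥-elim (<⇒≢ v<1 v≡1)) (λ ())

p<0⇒-1<-1-½p : ∀ {p} → p < 0ℚ → - 1ℚ < - 1ℚ - ½ * p
p<0⇒-1<-1-½p p<0 = +-monoʳ-< (- 1ℚ) (neg-antimono-< (*-monoʳ-<-pos ½ p<0))

-1≤p⇒-1-½p<0 : ∀ {p} → - 1ℚ ≤ p → - 1ℚ - ½ * p < 0ℚ
-1≤p⇒-1-½p<0 -1≤p = ≤-<-trans (+-monoʳ-≤ (- 1ℚ) (neg-antimono-≤ (*-monoˡ-≤-nonNeg ½ -1≤p))) decide-<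

-½<v⇒-v-½p<1 : ∀ {v p} → -½ < v → - 1ℚ ≤ p → - v - ½ * p < 1ℚ
-½<v⇒-v-½p<1 -½<v -1≤p = +-mono-<-≤ (neg-antimono-< -½<v) (neg-antimono-≤ (*-monoˡ-≤-nonNeg ½ -1≤p))

-1<p⇒-p<1 : ∀ {p} → - 1ℚ < p → - p < 1ℚ
-1<p⇒-p<1 = neg-antimono-<

0<p⇒1-½p<1 : ∀ {p} → 0ℚ < p → 1ℚ - ½ * p < 1ℚ
0<p⇒1-½p<1 0<p = +-monoʳ-< 1ℚ (neg-antimono-< (*-monoʳ-<-pos ½ 0<p))

lookahead : Bool → Bool → ℚ
lookahead true  false = ½
lookahead true  true  = 0ℚ
lookahead false true  = - (½ * ½)
lookahead false false = 0ℚ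

lookahead-bounds : ∀ aₙ₊₁ cₙ₊₁ → -½ < lookahead aₙ₊₁ cₙ₊₁ × lookahead aₙ₊₁ cₙ₊₁ < 1ℚ
lookahead-bounds true  false = decide-< , decide-<
lookahead-bounds true  true  = decide-< , decide-<
lookahead-bounds false true  = decide-< , decide-<
lookahead-bounds false false = decide-< , decide-<

-- p is xₙ₋₁, and cₙ is the vertex with value −xₙ − ½xₙ₋₁, that is, c (n − 1) in Defs.
next : (bₙ aₙ cₙ aₙ₊₁ cₙ₊₁ : Bool) → ℚ → ℚ
next true  _     _     _    _    _ = 1ℚ
next false true  _     _    _    _ = - 1ℚ
next false false true  _    _    p = - 1ℚ - ½ * p
next false false false aₙ₊₁ cₙ₊₁ _ = lookahead aₙ₊₁ cₙ₊₁

-- The invariant on xₙ₋₁ that lets the value −xₙ − ½xₙ₋₁ at cₙ be 1 exactly when cₙ ∈ S.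
-- If aₙ ∈ S then xₙ = −1 and that value is 1 − ½xₙ₋₁; if only cₙ ∈ S then xₙ = −1 − ½xₙ₋₁,
-- which must lie in (−1, 0).
Admissible : Bool → Bool → ℚ → Set
Admissible false false p = - 1ℚ ≤ p
Admissible true  false p = 0ℚ < p
Admissible false true  p = - 1ℚ ≤ p × p < 0ℚ
Admissible true  true  p = p ≡ 0ℚ

next-admissible : ∀ bₙ aₙ cₙ aₙ₊₁ cₙ₊₁ {p} → aₙ ∧ aₙ₊₁ ≡ false → bₙ ∧ cₙ₊₁ ≡ false → cₙ ∧ aₙ₊₁ ≡ false →
                  Admissible aₙ cₙ p → Admissible aₙ₊₁ cₙ₊₁ (next bₙ aₙ cₙ aₙ₊₁ cₙ₊₁ p)
next-admissible true  _     _     false false _  _  _  _ = decide-≤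
next-admissible true  _     _     true  false _  _  _  _ = decide-<
next-admissible true  _     _     _     true  _  () _  _
next-admissible false true  _     true  _     () _  _  _
next-admissible false true  _     false false _  _  _  _ = decide-≤
next-admissible false true  _     false true  _  _  _  _ = decide-≤ , decide-<
next-admissible false false true  true  _     _  _  () _
next-admissible false false true  false false _  _  _  (_ , p<0) = <⇒≤ (p<0⇒-1<-1-½p p<0)
next-admissible false false true  false true  _  _  _  (-1≤p , p<0) =
  <⇒≤ (p<0⇒-1<-1-½p p<0) , -1≤p⇒-1-½p<0 -1≤p
next-admissible false false false true  false _  _  _  _ = decide-<
next-admissible false false false true  true  _  _  _  _ = refl
next-admissible false false false false true  _  _  _  _ = decide-≤ , decide-<
next-admissible false false false false false _  _  _  _ = decide-≤

tight-b : ∀ bₙ aₙ cₙ aₙ₊₁ cₙ₊₁ {p} → Admissible aₙ cₙ p → Tight (next bₙ aₙ cₙ aₙ₊₁ cₙ₊₁ p) bₙ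
tight-b true  _     _     _    _    _          = tight refl
tight-b false true  _     _    _    _          = slack decide-<
tight-b false false true  _    _    (-1≤p , _) = slack (<-trans (-1≤p⇒-1-½p<0 -1≤p) decide-<)
tight-b false false false aₙ₊₁ cₙ₊₁ _          = slack (proj₂ (lookahead-bounds aₙ₊₁ cₙ₊₁))

tight-a : ∀ bₙ aₙ cₙ aₙ₊₁ cₙ₊₁ {p} → aₙ ∧ bₙ ≡ false → Admissible aₙ cₙ p →
          Tight (- next bₙ aₙ cₙ aₙ₊₁ cₙ₊₁ p) aₙ
tight-a true  true  _     _    _    () _
tight-a true  false _     _    _    _  _         = slack decide-<
tight-a false true  _     _    _    _  _         = tight refl
tight-a false false true  _    _    _  (_ , p<0) = slack (-1<p⇒-p<1 (p<0⇒-1<-1-½p p<0))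
tight-a false false false aₙ₊₁ cₙ₊₁ _  _         =
  slack (-1<p⇒-p<1 (<-trans decide-< (proj₁ (lookahead-bounds aₙ₊₁ cₙ₊₁))))

tight-c : ∀ bₙ aₙ cₙ aₙ₊₁ cₙ₊₁ {p} → aₙ ∧ bₙ ≡ false → bₙ ∧ cₙ ≡ false → Admissible aₙ cₙ p →
          Tight (- next bₙ aₙ cₙ aₙ₊₁ cₙ₊₁ p - ½ * p) cₙ
tight-c true  true  _     _    _    () _  _
tight-c true  false true  _    _    _  () _
tight-c true  false false _    _    _  _  -1≤p = slack (-½<v⇒-v-½p<1 {1ℚ} decide-< -1≤p)
tight-c false true  false _    _    _  _  0<p  = slack (0<p⇒1-½p<1 0<p)
tight-c false true  true  _    _    _  _  refl = tight refl
tight-c false false true  _    _    {p} _ _ _  =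
  tight (solve 1 (λ p → :- (:- con 1ℚ :- con ½ :* p) :- con ½ :* p := con 1ℚ) refl p)
tight-c false false false aₙ₊₁ cₙ₊₁ _  _  -1≤p =
  slack (-½<v⇒-v-½p<1 (proj₁ (lookahead-bounds aₙ₊₁ cₙ₊₁)) -1≤p)

-- C shifts the memberships C′ of the vertices c j to the indexing used by next.
module SupportingFunctional (A B C′ : ℕ → Bool)
  (no-ab  : ∀ n → A n ∧ B n ≡ false)
  (no-aa  : ∀ n → A n ∧ A (suc n) ≡ false)
  (no-bc₁ : ∀ n → B n ∧ C′ n ≡ false)
  (no-bc₂ : ∀ n → B (suc n) ∧ C′ n ≡ false)
  (no-ca  : ∀ n → C′ n ∧ A (suc (suc n)) ≡ false)
  where

  C : ℕ → Bool
  C zero    = false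
  C (suc n) = C′ n

  no-bc₂′ : ∀ n → B n ∧ C n ≡ false
  no-bc₂′ zero    = ∧-zeroʳ (B 0)
  no-bc₂′ (suc n) = no-bc₂ n

  no-ca′ : ∀ n → C n ∧ A (suc n) ≡ false
  no-ca′ zero    = refl
  no-ca′ (suc n) = no-ca n

  previous : ℕ → ℚ
  previous zero    = ½
  previous (suc n) = next (B n) (A n) (C n) (A (suc n)) (C (suc n)) (previous n)

  x : ℕ → ℚ
  x n = previous (suc n)

  admissible : ∀ n → Admissible (A n) (C n) (previous n)
  admissible zero    = phantom (A 0)
    where
    -- x₋₁ is a phantom coordinate (there is no c₀); ½ is admissible whatever a₀ is.
    phantom : ∀ a₀ → Admissible a₀ false ½
    phantom true  = decide-<
    phantom false = decide-≤
  admissible (suc n) =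
    next-admissible (B n) (A n) (C n) (A (suc n)) (C (suc n)) (no-aa n) (no-bc₁ n) (no-ca′ n) (admissible n)

  a-tight : ∀ n → Tight (- x n) (A n)
  a-tight n = tight-a (B n) (A n) (C n) (A (suc n)) (C (suc n)) (no-ab n) (admissible n)

  b-tight : ∀ n → Tight (x n) (B n)
  b-tight n = tight-b (B n) (A n) (C n) (A (suc n)) (C (suc n)) (admissible n)

  c-tight : ∀ n → Tight (- x (suc n) - ½ * x n) (C′ n)
  c-tight n = tight-c (B (suc n)) (A (suc n)) (C (suc n)) (A (suc (suc n))) (C (suc (suc n)))
                      (no-ab (suc n)) (no-bc₂′ (suc n)) (admissible (suc n))

∧≡false : ∀ {p q : Bool} → (p ≡ true → q ≡ true → ⊥) → p ∧ q ≡ false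
∧≡false {false}         _ = refl
∧≡false {true}  {false} _ = refl
∧≡false {true}  {true}  p∧q = ⊥-elim (p∧q refl refl)

module IndependentSet {m} (S : Subset (suc m)) (independent : IndFace (suc m) S) where

  A B C′ : ℕ → Bool
  A  = extend false (S ∘ a)
  B  = extend false (S ∘ b)
  C′ = extend false (S ∘ c)

  excluded : ∀ {d d′} (u : Fin d → Vtx (suc m)) (v : Fin d′ → Vtx (suc m)) k l →
             (∀ i j → toℕ i ≡ k → toℕ j ≡ l → Edge (u i) (v j)) →
             extend false (S ∘ u) k ∧ extend false (S ∘ v) l ≡ false
  excluded u v k l edge = ∧≡false λ Sᵤ Sᵥ →
    let i , i≡k , Suᵢ = extend-witness (S ∘ u) Sᵤ
        j , j≡l , Svⱼ = extend-witness (S ∘ v) Sᵥ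
    in independent (u i) (v j) Suᵢ Svⱼ (inj₁ (edge i j i≡k j≡l))

  open SupportingFunctional A B C′
    (λ n → excluded a b n n λ i j i≡n j≡n → ab i j (trans i≡n (sym j≡n)))
    (λ n → excluded a a n (suc n) λ i j i≡n j≡1+n → aa i j (trans (cong suc i≡n) (sym j≡1+n)))
    (λ n → excluded b c n n λ i j i≡n j≡n → bc₁ i j (trans i≡n (sym j≡n)))
    (λ n → excluded b c (suc n) n λ i j i≡1+n j≡n → bc₂ i j (trans i≡1+n (cong suc (sym j≡n))))
    (λ n → excluded c a n (suc (suc n)) λ j i j≡n i≡2+n → ca j i (trans i≡2+n (cong (suc ∘ suc) (sym j≡n))))

  value-tight : ∀ v → Tight (value x v) (S v)
  value-tight (a i) = subst (Tight _) (extend-toℕ false (S ∘ a) i) (a-tight (toℕ i))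
  value-tight (b i) = subst (Tight _) (extend-toℕ false (S ∘ b) i) (b-tight (toℕ i))
  value-tight (c j) = subst (Tight _) (extend-toℕ false (S ∘ c) j) (c-tight (toℕ j))

  α : Pt (suc m)
  α = x ∘ toℕ

  α-tight : ∀ v → Tight (α · point v) (S v)
  α-tight v = subst (λ t → Tight t (S v)) (sym α·v≡x·v) (value-tight v)
    where
    α·v≡x·v : α · point v ≡ value x v
    α·v≡x·v = trans (·-point α v) (value-cong (extend-∘toℕ 0ℚ x) v)

  face : ProperFaceSet point S
  face = (α , 1ℚ , proj₁ ∘ α-tight , proj₂ ∘ α-tight)
       , λ all → independent (a Fin.zero) (b Fin.zero) (all _) (all _) (inj₁ (ab Fin.zero Fin.zero refl))

independent⇒face : ∀ {m} S → IndFace (suc m) S → ProperFaceSet (point {suc m}) S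
independent⇒face = IndependentSet.face

delete-independent : ∀ {m} {S} v → IndFace m S → IndFace m (delete v S)
delete-independent {S = S} v independent u w u∈ w∈ = independent u w (delete-⊆ S u∈) (delete-⊆ S w∈)

corollary3p15 : (m : ℕ) → m ≥ 1 → IsSimplicialPolytopeBoundary m m (IndFace m)
corollary3p15 (suc m) _ =
  point , point-fullDim , simplicial-if-deletion-closed point deletion-closed , faces
  where
  faces : ∀ S → IndFace (suc m) S ⇔ ProperFaceSet point S
  faces S = mk⇔ (independent⇒face S) (face⇒independent S)
  deletion-closed : ∀ S v → ProperFaceSet point S → S v ≡ true → ProperFaceSet point (delete v S)
  deletion-closed S v face _ = independent⇒face (delete v S) (delete-independent v (face⇒independent S face))
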